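{- Let $H$ be a reduced commutative cancellative monoid containing at least one element of infinite order. Then $H\setminus H_v$ is a subsemigroup of $H$ (possibly empty), $H_v$ is a valuation submonoid of $H$, and $(H\setminus H_v)\cdot\mathsf{q}(H_v)=H\setminus H_v$.
   Context: $H$ is reduced if its only unit is $1_H$. $\mathsf{q}(H)$ is the quotient group of $H$, with $H\subseteq\mathsf{q}(H)$, and $\mathsf{q}(H_v)$ is the subgroup generated by $H_v$. A commutative cancellative monoid $M$ is a valuation monoid if for every $x\in\mathsf{q}(M)$, $x\in M$ or $x^{ -1}\in M$. An element $a\in H$ is a pseudo-unit of $H$ if for all $b\in H$, $ab^{ -1}\in H$ or $ba^{ -1}\in H$; $H_v$ denotes the set of pseudo-units of $H$. -}

module Defs where

open import Level using (_⊔_)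
open import Algebra.Bundles using (CommutativeMonoid)
open import Data.Product using (Σ; ∃; _×_; _,_)
open import Data.Sum using (_⊎_)
open import Data.Nat using (ℕ; zero; suc)
open import Relation.Nullary using (¬_)
open import Relation.Binary.PropositionalEquality using (_≡_)

module _ {c ℓ} (H : CommutativeMonoid c ℓ) where
  open CommutativeMonoid H renaming (Carrier to C)

  -- cancellative: a b = a d ⇒ b = d (commutative, so one side suffices)
  IsCancellative : Set (c ⊔ ℓ)
  IsCancellative = ∀ a b d → a ∙ b ≈ a ∙ d → b ≈ d

  IsUnit : C → Set (c ⊔ ℓ)
  IsUnit u = ∃ λ v → u ∙ v ≈ ε

  IsReduced : Set (c ⊔ ℓ)
  IsReduced = ∀ u → IsUnit u → u ≈ ε

  pow : ℕ → C → C
  pow zero    a = ε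
  pow (suc n) a = a ∙ pow n a

  HasInfiniteOrder : C → Set ℓ
  HasInfiniteOrder a = ∀ n m → pow n a ≈ pow m a → n ≡ m

  -- Quotient group q(H) (standard construction for a cancellative
  -- commutative monoid): pairs (a , b) standing for a b⁻¹, as a setoid.
  Q : Set c
  Q = C × C

  _~_ : Q → Q → Set ℓ
  (a , b) ~ (a' , b') = a ∙ b' ≈ a' ∙ b

  _·_ : Q → Q → Q
  (a , b) · (a' , b') = (a ∙ a' , b ∙ b')

  qinv : Q → Q
  qinv (a , b) = (b , a)

  qone : Q
  qone = (ε , ε)

  emb : C → Q
  emb a = (a , ε)

  _/_ : C → C → Q
  a / b = (a , b)

  InH : Q → Set (c ⊔ ℓ)
  InH x = ∃ λ h → x ~ emb h

  IsPseudoUnit : C → Set (c ⊔ ℓ)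
  IsPseudoUnit a = ∀ b → InH (a / b) ⊎ InH (b / a)

  InHv : Q → Set (c ⊔ ℓ)
  InHv x = ∃ λ h → IsPseudoUnit h × x ~ emb h

  data InQHv : Q → Set (c ⊔ ℓ) where
    gen-base : ∀ {x} → InHv x → InQHv x
    gen-one  : InQHv qone
    gen-mul  : ∀ {x y} → InQHv x → InQHv y → InQHv (x · y)
    gen-inv  : ∀ {x} → InQHv x → InQHv (qinv x)
    gen-resp : ∀ {x y} → x ~ y → InQHv x → InQHv y

  ComplementIsSubsemigroup : Set (c ⊔ ℓ)
  ComplementIsSubsemigroup =
    ∀ a b → ¬ IsPseudoUnit a → ¬ IsPseudoUnit b → ¬ IsPseudoUnit (a ∙ b)

  HvIsSubmonoid : Set (c ⊔ ℓ)
  HvIsSubmonoid =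
    IsPseudoUnit ε × (∀ a b → IsPseudoUnit a → IsPseudoUnit b → IsPseudoUnit (a ∙ b))

  HvIsValuation : Set (c ⊔ ℓ)
  HvIsValuation = ∀ x → InQHv x → InHv x ⊎ InHv (qinv x)

  ComplementTimesQHv : Set (c ⊔ ℓ)
  ComplementTimesQHv = ∀ z →
    ((∃ λ y → ∃ λ x → ¬ IsPseudoUnit y × InQHv x × z ~ (emb y · x))
      → (∃ λ y → ¬ IsPseudoUnit y × z ~ emb y))
    × ((∃ λ y → ¬ IsPseudoUnit y × z ~ emb y)
      → (∃ λ y → ∃ λ x → ¬ IsPseudoUnit y × InQHv x × z ~ (emb y · x)))

-- Write a ∣ b for divisibility in H.  Then a is a pseudo-unit exactly when it is
-- comparable with every b (b ∣ a or a ∣ b), and with cancellation the comparable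
-- elements are closed under products and under taking divisors.  Divisor-closure
-- makes H ∖ H_v a semigroup; product-closure makes H_v a monoid and shows that
-- every element of q(H_v) is a quotient u/v of pseudo-units, and comparing u with
-- v gives the valuation property.  For y ∉ H_v and u/v ∈ q(H_v), comparing v with
-- y u shows y u = q v with q ∉ H_v, since y u ∣ v or q ∈ H_v would put y into H_v.
module Submission where

open import Level using (_⊔_)
open import Algebra.Bundles using (CommutativeMonoid)
open import Data.Product using (∃; ∃₂; _×_; _,_)
open import Data.Sum as Sum using (_⊎_; inj₁; inj₂)
open import Data.Empty using (⊥-elim)
open import Relation.Nullary using (¬_)
open import Defs hiding (_~_; _·_)
import Defs
import Algebra.Solver.CommutativeMonoid as CommutativeMonoidSolver
import Algebra.Properties.CommutativeSemigroup.Divisibility as Divisibility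
import Algebra.Properties.Monoid.Divisibility as MonoidDivisibility
import Relation.Binary.Reasoning.Setoid as SetoidReasoning

module PseudoUnits {c ℓ} (H : CommutativeMonoid c ℓ) (cancel : IsCancellative H) where
  open CommutativeMonoid H renaming (Carrier to C)
  open CommutativeMonoidSolver H
  open Divisibility commutativeSemigroup
  open MonoidDivisibility monoid using (ε∣ʳ_)
  open import Algebra.Properties.CommutativeSemigroup commutativeSemigroup using (interchange)
  open SetoidReasoning setoid

  ∣-cancelʳ : ∀ {x y} z → x ∙ z ∣ y ∙ z → x ∣ y
  ∣-cancelʳ {x} {y} z (q , qxz≈yz) = q , cancel z (q ∙ x) y (begin
    z ∙ (q ∙ x) ≈⟨ solve 3 (λ z q x → z ⊕ (q ⊕ x) ⊜ q ⊕ (x ⊕ z)) refl z q x ⟩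
    q ∙ (x ∙ z) ≈⟨ qxz≈yz ⟩
    y ∙ z       ≈⟨ comm y z ⟩
    z ∙ y       ∎)

  Comparable : C → Set (c ⊔ ℓ)
  Comparable a = ∀ b → b ∣ a ⊎ a ∣ b

  ε-comparable : Comparable ε
  ε-comparable b = inj₂ (ε∣ʳ b)

  ∙-comparable : ∀ {a a'} → Comparable a → Comparable a' → Comparable (a ∙ a')
  ∙-comparable {a} {a'} ca ca' b with ca b
  ... | inj₁ b∣a = inj₁ (∣ʳ-respʳ-≈ (comm a' a) (x∣ʳy⇒x∣ʳzy a' b∣a))
  ... | inj₂ (q , qa≈b) with ca' q
  ...   | inj₁ q∣a' = inj₁ (∣ʳ-respˡ-≈ qa≈b (∣ʳ-respʳ-≈ (comm a' a) (x∣ʳy⇒xz∣ʳyz a q∣a')))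
  ...   | inj₂ a'∣q = inj₂ (∣ʳ-respʳ-≈ (trans (comm a q) qa≈b) (x∣y⇒zx∣zy a a'∣q))

  -- Compare a = k d with b k and cancel k.
  comparable-∣ : ∀ {d a} → d ∣ a → Comparable a → Comparable d
  comparable-∣ {d} (k , kd≈a) ca b with ca (b ∙ k) | trans (sym kd≈a) (comm k d)
  ... | inj₁ bk∣a | a≈dk = inj₁ (∣-cancelʳ k (∣ʳ-respʳ-≈ a≈dk bk∣a))
  ... | inj₂ a∣bk | a≈dk = inj₂ (∣-cancelʳ k (∣ʳ-respˡ-≈ a≈dk a∣bk))

  ∈H⇒∣ : ∀ {a b} → InH H (a , b) → b ∣ a
  ∈H⇒∣ {a} (h , aε≈hb) = h , trans (sym aε≈hb) (identityʳ a)

  ∣⇒∈H : ∀ {a b} → b ∣ a → InH H (a , b)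
  ∣⇒∈H {a} (h , hb≈a) = h , trans (identityʳ a) (sym hb≈a)

  pseudoUnit⇒comparable : ∀ {a} → IsPseudoUnit H a → Comparable a
  pseudoUnit⇒comparable pa b = Sum.map ∈H⇒∣ ∈H⇒∣ (pa b)

  comparable⇒pseudoUnit : ∀ {a} → Comparable a → IsPseudoUnit H a
  comparable⇒pseudoUnit ca b = Sum.map ∣⇒∈H ∣⇒∈H (ca b)

  ¬pseudoUnit⇒¬comparable : ∀ {a} → ¬ IsPseudoUnit H a → ¬ Comparable a
  ¬pseudoUnit⇒¬comparable ¬pa ca = ¬pa (comparable⇒pseudoUnit ca)

  _~_ : Q H → Q H → Set ℓ
  _~_ = Defs._~_ H

  _·_ : Q H → Q H → Q H
  _·_ = Defs._·_ H

  ~-sym : ∀ {x y} → x ~ y → y ~ x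
  ~-sym = sym

  ~-trans : ∀ {x y z} → x ~ y → y ~ z → x ~ z
  ~-trans {a , b} {a' , b'} {a'' , b''} ab'≈a'b a'b''≈a''b' = cancel b' (a ∙ b'') (a'' ∙ b) (begin
    b' ∙ (a ∙ b'')  ≈⟨ solve 3 (λ b' a b'' → b' ⊕ (a ⊕ b'') ⊜ (a ⊕ b') ⊕ b'') refl b' a b'' ⟩
    (a ∙ b') ∙ b''  ≈⟨ ∙-congʳ ab'≈a'b ⟩
    (a' ∙ b) ∙ b''  ≈⟨ solve 3 (λ a' b b'' → (a' ⊕ b) ⊕ b'' ⊜ (a' ⊕ b'') ⊕ b) refl a' b b'' ⟩
    (a' ∙ b'') ∙ b  ≈⟨ ∙-congʳ a'b''≈a''b' ⟩
    (a'' ∙ b') ∙ b  ≈⟨ solve 3 (λ a'' b' b → (a'' ⊕ b') ⊕ b ⊜ b' ⊕ (a'' ⊕ b)) refl a'' b' b ⟩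
    b' ∙ (a'' ∙ b)  ∎)

  ·-cong : ∀ {x x' y y'} → x ~ x' → y ~ y' → (x · y) ~ (x' · y')
  ·-cong {a , b} {a' , b'} {d , e} {d' , e'} ab'≈a'b de'≈d'e = begin
    (a ∙ d) ∙ (b' ∙ e')  ≈⟨ interchange a d b' e' ⟩
    (a ∙ b') ∙ (d ∙ e')  ≈⟨ ∙-cong ab'≈a'b de'≈d'e ⟩
    (a' ∙ b) ∙ (d' ∙ e)  ≈⟨ interchange a' b d' e ⟩
    (a' ∙ d') ∙ (b ∙ e)  ∎

  qinv-cong : ∀ {x y} → x ~ y → qinv H x ~ qinv H y
  qinv-cong {a , b} {a' , b'} ab'≈a'b = trans (comm b a') (trans (sym ab'≈a'b) (comm a b'))

  ~-emb : ∀ {x u v q} → x ~ (u , v) → q ∙ v ≈ u → x ~ emb H q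
  ~-emb {a , b} {u} {v} {q} av≈ub qv≈u = cancel v (a ∙ ε) (q ∙ b) (begin
    v ∙ (a ∙ ε)  ≈⟨ solve 2 (λ v a → v ⊕ (a ⊕ id) ⊜ a ⊕ v) refl v a ⟩
    a ∙ v        ≈⟨ av≈ub ⟩
    u ∙ b        ≈⟨ ∙-congʳ (sym qv≈u) ⟩
    (q ∙ v) ∙ b  ≈⟨ solve 3 (λ q v b → (q ⊕ v) ⊕ b ⊜ v ⊕ (q ⊕ b)) refl q v b ⟩
    v ∙ (q ∙ b)  ∎)

  QuotientOfPseudoUnits : Q H → Set (c ⊔ ℓ)
  QuotientOfPseudoUnits x = ∃₂ λ u v → Comparable u × Comparable v × x ~ (u , v)

  inQHv⇒quotientOfPseudoUnits : ∀ {x} → InQHv H x → QuotientOfPseudoUnits x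
  inQHv⇒quotientOfPseudoUnits (gen-base (h , ph , x~h)) =
    h , ε , pseudoUnit⇒comparable ph , ε-comparable , x~h
  inQHv⇒quotientOfPseudoUnits gen-one = ε , ε , ε-comparable , ε-comparable , refl
  inQHv⇒quotientOfPseudoUnits (gen-mul x∈ y∈)
    with inQHv⇒quotientOfPseudoUnits x∈ | inQHv⇒quotientOfPseudoUnits y∈
  ... | u , v , cu , cv , x~u/v | u' , v' , cu' , cv' , y~u'/v' =
    u ∙ u' , v ∙ v' , ∙-comparable cu cu' , ∙-comparable cv cv' , ·-cong x~u/v y~u'/v'
  inQHv⇒quotientOfPseudoUnits (gen-inv x∈) with inQHv⇒quotientOfPseudoUnits x∈
  ... | u , v , cu , cv , x~u/v = v , u , cv , cu , qinv-cong x~u/v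
  inQHv⇒quotientOfPseudoUnits (gen-resp x~y x∈) with inQHv⇒quotientOfPseudoUnits x∈
  ... | u , v , cu , cv , x~u/v = u , v , cu , cv , ~-trans (~-sym x~y) x~u/v

  pseudoUnit-ε : IsPseudoUnit H ε
  pseudoUnit-ε = comparable⇒pseudoUnit ε-comparable

  pseudoUnit-∙ : ∀ a b → IsPseudoUnit H a → IsPseudoUnit H b → IsPseudoUnit H (a ∙ b)
  pseudoUnit-∙ _ _ pa pb =
    comparable⇒pseudoUnit (∙-comparable (pseudoUnit⇒comparable pa) (pseudoUnit⇒comparable pb))

  nonPseudoUnits-∙ : ComplementIsSubsemigroup H
  nonPseudoUnits-∙ a b ¬pa _ pab =
    ¬pseudoUnit⇒¬comparable ¬pa (comparable-∣ (x∣xy a b) (pseudoUnit⇒comparable pab))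

  pseudoUnits-valuation : HvIsValuation H
  pseudoUnits-valuation x x∈ with inQHv⇒quotientOfPseudoUnits x∈
  ... | u , v , cu , cv , x~u/v with cu v
  ...   | inj₁ (q , qv≈u) =
    inj₁ (q , comparable⇒pseudoUnit (comparable-∣ (xy≈z⇒x∣z q v qv≈u) cu) , ~-emb x~u/v qv≈u)
  ...   | inj₂ (q , qu≈v) =
    inj₂ (q , comparable⇒pseudoUnit (comparable-∣ (xy≈z⇒x∣z q u qu≈v) cv) , ~-emb (qinv-cong x~u/v) qu≈v)

  emb-·-qone : ∀ y → emb H y ~ (emb H y · qone H)
  emb-·-qone y = solve 1 (λ y → (y ⊕ (id ⊕ id)) ⊜ ((y ⊕ id) ⊕ id)) refl y

  emb-·-~ : ∀ y u v → (emb H y · (u , v)) ~ (y ∙ u , v)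
  emb-·-~ y u v = solve 3 (λ y u v → (y ⊕ u) ⊕ v ⊜ (y ⊕ u) ⊕ (id ⊕ v)) refl y u v

  nonPseudoUnits-·-qHv : ComplementTimesQHv H
  nonPseudoUnits-·-qHv z = absorb , extend
    where
    absorb : (∃₂ λ y x → ¬ IsPseudoUnit H y × InQHv H x × z ~ (emb H y · x))
           → ∃ λ y → ¬ IsPseudoUnit H y × z ~ emb H y
    absorb (y , x , ¬py , x∈ , z~yx) with inQHv⇒quotientOfPseudoUnits x∈
    ... | u , v , cu , cv , x~u/v with cv (y ∙ u)
    ...   | inj₁ yu∣v =
      ⊥-elim (¬pseudoUnit⇒¬comparable ¬py (comparable-∣ (∣ʳ-trans (x∣xy y u) yu∣v) cv))
    ...   | inj₂ (q , qv≈yu) = q , ¬pq , ~-emb z~yu/v qv≈yu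
      where
      z~yu/v : z ~ (y ∙ u , v)
      z~yu/v = ~-trans z~yx (~-trans (·-cong {emb H y} refl x~u/v) (emb-·-~ y u v))

      ¬pq : ¬ IsPseudoUnit H q
      ¬pq pq = ¬pseudoUnit⇒¬comparable ¬py
        (comparable-∣ (∣ʳ-respʳ-≈ (sym qv≈yu) (x∣xy y u)) (∙-comparable (pseudoUnit⇒comparable pq) cv))

    extend : (∃ λ y → ¬ IsPseudoUnit H y × z ~ emb H y)
           → ∃₂ λ y x → ¬ IsPseudoUnit H y × InQHv H x × z ~ (emb H y · x)
    extend (y , ¬py , z~y) = y , qone H , ¬py , gen-one , ~-trans z~y (emb-·-qone y)

lemma15 : ∀ {c ℓ} (H : CommutativeMonoid c ℓ) →
    IsCancellative H → IsReduced H → (∃ λ a → HasInfiniteOrder H a) →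
    ComplementIsSubsemigroup H × (HvIsSubmonoid H × HvIsValuation H) × ComplementTimesQHv H
lemma15 H cancel _ _ =
  nonPseudoUnits-∙ , ((pseudoUnit-ε , pseudoUnit-∙) , pseudoUnits-valuation) , nonPseudoUnits-·-qHv
  where open PseudoUnits H cancel
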